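{- Let $\mathcal{V}$ be a solution of Highly Connected List Allocation for an instance $I=(G,r,\lambda,\alpha)$ with $|V(G)|>2w\cdot f_2(w)$, where $w=\sum\alpha$. Then there is a unique $j\in[r]$ such that $\mathcal{V}$ is $w\cdot f_2(w)$-bounded out of $j$, and a unique connected component $C$ of $G\setminus E(\mathcal{V})$ with $|V(C)|>f_2(w)$. Moreover, for such $C$ and $j$, $C$ is a subgraph of $G[\mathcal{V}^{(j)}]$.
   Context: Graphs are loopless and may have multiple edges. List Allocation: instance $(G,r,\lambda,\alpha)$ with $r\ge1$, $\lambda:V(G)\to2^{[r]}$, $\alpha:\binom{[r]}{2}\to\mathbb{Z}_{\ge0}$; a solution is an $r$-tuple $\mathcal{V}=(\mathcal{V}^{(1)},\ldots,\mathcal{V}^{(r)})$ of pairwise disjoint possibly empty sets with union $V(G)$ such that for distinct $i,j$ exactly $\alpha(i,j)$ edges join $\mathcal{V}^{(i)}$ and $\mathcal{V}^{(j)}$ and $v\in\mathcal{V}^{(i)}$ implies $i\in\lambda(v)$. $E(\mathcal{V})$ is the set of edges with endpoints in different parts of $\mathcal{V}$. $f_1(w)=2^w(2w)^{2w}$, $f_2(w)=wf_1(w)+1$. For a connected graph $G$, a partition $(V_1,V_2)$ of $V(G)$ is a $(q,y)$-good separation if $|V_1|,|V_2|>q$, at most $y$ edges join $V_1$ and $V_2$, and $G[V_1],G[V_2]$ are connected; $G$ is $(q,y)$-connected if it has no $(q,y-1)$-good separation. Highly Connected List Allocation: instances with $G$ connected, $r\le 2w$, and $G$ $(f_2(w),w+1)$-connected.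 An allocation $\mathcal{V}$ is $x$-bounded out of $j$ if $\sum_{i\in[r]\setminus\{j\}}|\mathcal{V}^{(i)}|\le x$. -}

module Defs where

open import Data.Nat using (ℕ; zero; suc; _+_; _*_; _^_; _≤_; _<_)
open import Data.Fin using (Fin; zero; suc; _≟_; _<?_)
open import Data.Fin.Subset using (Subset; _∈_; _∉_; ∣_∣)
open import Data.Fin.Subset.Properties using (_∈?_)
open import Data.Bool using (Bool; true; false; if_then_else_; _∧_; _∨_; _xor_)
open import Data.Product using (Σ; _×_; _,_; proj₁; proj₂; ∃)
open import Relation.Nullary using (¬_)
open import Relation.Nullary.Decidable using (⌊_⌋)
open import Relation.Binary.PropositionalEquality using (_≡_; _≢_)

sumFin : ∀ {k} → (Fin k → ℕ) → ℕ
sumFin {zero}  f = 0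
sumFin {suc k} f = f zero + sumFin (λ i → f (suc i))

count : ∀ {k} → (Fin k → Bool) → ℕ
count p = sumFin (λ i → if p i then 1 else 0)

f₁ : ℕ → ℕ
f₁ w = 2 ^ w * (2 * w) ^ (2 * w)

f₂ : ℕ → ℕ
f₂ w = w * f₁ w + 1

-- Loopless multigraphs: vertices Fin n, edges Fin m, each edge has
-- two (distinct) endpoints.  Parallel edges are allowed.

record Graph : Set where
  field
    n        : ℕ
    m        : ℕ
    ends     : Fin m → Fin n × Fin n
    loopless : ∀ e → proj₁ (ends e) ≢ proj₂ (ends e)
open Graph public

Vertex : Graph → Set
Vertex G = Fin (n G)

Edge : Graph → Set
Edge G = Fin (m G)

src tgt : (G : Graph) → Edge G → Vertex G
src G e = proj₁ (ends G e)
tgt G e = proj₂ (ends G e)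

-- Walks in the spanning subgraph of G consisting of the edges satisfying ok.
data Walk (G : Graph) (ok : Edge G → Set) : Vertex G → Vertex G → Set where
  here  : ∀ {u} → Walk G ok u u
  fwd   : ∀ {v} e → ok e → Walk G ok (tgt G e) v → Walk G ok (src G e) v
  bwd   : ∀ {v} e → ok e → Walk G ok (src G e) v → Walk G ok (tgt G e) v

AllEdges : (G : Graph) → Edge G → Set
AllEdges G e = Data.Unit.⊤
  where import Data.Unit

Connected : Graph → Set
Connected G = ∀ u v → Walk G (AllEdges G) u v

InducedEdge : (G : Graph) → Subset (n G) → Edge G → Set
InducedEdge G S e = (src G e ∈ S) × (tgt G e ∈ S)

InducedConnected : (G : Graph) → Subset (n G) → Set
InducedConnected G S = ∀ u v → u ∈ S → v ∈ S → Walk G (InducedEdge G S) u v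

crossing : (G : Graph) → Subset (n G) → ℕ
crossing G S = count (λ e → ⌊ src G e ∈? S ⌋ xor ⌊ tgt G e ∈? S ⌋)

complement : ∀ {k} → Subset k → Subset k
complement = Data.Fin.Subset.∁
  where import Data.Fin.Subset

GoodSeparation : (G : Graph) → ℕ → ℕ → Subset (n G) → Set
GoodSeparation G q y V₁ =
  (q < ∣ V₁ ∣) × (q < ∣ complement V₁ ∣) × (crossing G V₁ ≤ y) ×
  InducedConnected G V₁ × InducedConnected G (complement V₁)

-- (q,y)-connected: no (q,y-1)-good separation.  We only use it with
-- y = w+1, so we phrase it as "no (q,y')-good separation" with y' = y - 1
-- supplied by the caller.
NoGoodSeparation : (G : Graph) → ℕ → ℕ → Set
NoGoodSeparation G q y' = ∀ V₁ → ¬ GoodSeparation G q y' V₁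

-- List Allocation.
-- r parts indexed by Fin r; λ : vertex → Subset r;
-- α on unordered pairs {i,j} is encoded by its values α i j with i < j
-- (values with i ≥ j are irrelevant).
-- An allocation 𝒱 = (𝒱⁽¹⁾,…,𝒱⁽ʳ⁾) (pairwise disjoint, union V(G)) is
-- encoded by the function part : vertex → Fin r  (v ∈ 𝒱⁽ⁱ⁾ iff part v ≡ i).

edgesBetween : (G : Graph) {r : ℕ} → (Vertex G → Fin r) → Fin r → Fin r → ℕ
edgesBetween G part i j =
  count (λ e → (⌊ part (src G e) ≟ i ⌋ ∧ ⌊ part (tgt G e) ≟ j ⌋)
             ∨ (⌊ part (src G e) ≟ j ⌋ ∧ ⌊ part (tgt G e) ≟ i ⌋))

IsSolution : (G : Graph) (r : ℕ) (lam : Vertex G → Subset r)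
             (α : Fin r → Fin r → ℕ) (part : Vertex G → Fin r) → Set
IsSolution G r lam α part =
  (∀ (i j : Fin r) → Data.Fin._<_ i j → edgesBetween G part i j ≡ α i j) ×
  (∀ v → part v ∈ lam v)

totalα : ∀ {r} → (Fin r → Fin r → ℕ) → ℕ
totalα α = sumFin (λ i → sumFin (λ j → if ⌊ i <? j ⌋ then α i j else 0))

HighlyConnected : (G : Graph) (r : ℕ) (α : Fin r → Fin r → ℕ) → Set
HighlyConnected G r α =
  Connected G × (r ≤ 2 * totalα α) ×
  NoGoodSeparation G (f₂ (totalα α)) (totalα α)
  -- (f₂(w), w+1)-connected = no (f₂(w), w)-good separation

partSize : (G : Graph) {r : ℕ} → (Vertex G → Fin r) → Fin r → ℕ
partSize G part i = count (λ v → ⌊ part v ≟ i ⌋)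

BoundedOutOf : (G : Graph) {r : ℕ} → (Vertex G → Fin r) → ℕ → Fin r → Set
BoundedOutOf G part x j =
  sumFin (λ i → if ⌊ i ≟ j ⌋ then 0 else partSize G part i) ≤ x

-- edges of G ∖ E(𝒱): edges whose endpoints lie in the same part
NotCut : (G : Graph) {r : ℕ} → (Vertex G → Fin r) → Edge G → Set
NotCut G part e = part (src G e) ≡ part (tgt G e)

-- C is (the vertex set of) a connected component of G ∖ E(𝒱):
-- the set of vertices reachable from some vertex v in G ∖ E(𝒱).
IsComponent : (G : Graph) {r : ℕ} → (Vertex G → Fin r) → Subset (n G) → Set
IsComponent G part C =
  Σ (Vertex G) λ v → ∀ u → (u ∈ C → Walk G (NotCut G part) v u)
                         × (Walk G (NotCut G part) v u → u ∈ C)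

-- the component C (with edge set the edges of G ∖ E(𝒱) inside C)
-- is a subgraph of G[𝒱⁽ʲ⁾]
SubgraphOfPart : (G : Graph) {r : ℕ} → (Vertex G → Fin r) → Subset (n G) → Fin r → Set
SubgraphOfPart G part C j =
  (∀ v → v ∈ C → part v ≡ j) ×
  (∀ e → NotCut G part e → src G e ∈ C → tgt G e ∈ C →
     (part (src G e) ≡ j) × (part (tgt G e) ≡ j))

module Submission where

-- Proof.  (1) A solution has at most w cut edges, each being counted by α
-- (cutSize≤totalα).  (2) Deleting an edge raises the number of components
-- by at most one, so G ∖ E(𝒱) has at most 1 + w components covering V(G)
-- (component-cover); components are computed as reachable sets (reachable).
-- (3) Two different components with more than f₂(w) vertices would yield an
-- (f₂(w), w)-good separation (module Separation), which G does not have
-- (large-component-unique).  (4) Counting over the cover: as n > 2 w f₂(w)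
-- ≥ (1 + w) f₂(w), some component C is large (some-large); all the others
-- are small, so at most w f₂(w) vertices lie outside C (few-outside).
-- (5) Uncut walks stay inside one part, so C ⊆ 𝒱⁽ʲ⁾ for the part j of C
-- (component-in-part); hence 𝒱 is bounded out of j (bounded-out-of), and
-- out of no other part since n > 2 w f₂(w) (bounded-unique).

open import Defs
open import Data.Nat using (ℕ; zero; suc; _+_; _*_; _≤_; _<_; z≤n; s≤s)
open import Data.Nat.Properties
  using (module ≤-Reasoning; ≤-refl; ≤-trans; ≤-reflexive; ≤-<-trans; <⇒≱; ≮⇒≥; ≰⇒>; _<?_; _≤?_;
         m≤m+n; m≤n+m; +-identityʳ; +-suc; +-mono-≤; +-monoˡ-≤;
         *-identityʳ; *-zeroʳ; *-assoc; *-monoˡ-≤; *-cancelˡ-<; +-0-commutativeMonoid)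
open import Data.Fin using (Fin; zero; suc; _≟_; fromℕ<) renaming (_<_ to _<ᶠ_; _<?_ to _<ᶠ?_)
open import Data.Fin.Properties using (all?; any?; ¬∀⟶∃¬; <-cmp)
open import Data.Fin.Subset using (Subset; ∣_∣; _∈_; _∉_; _∪_; ⁅_⁆; _⊆_; _⊂_; ∁)
open import Data.Fin.Subset.Properties
  using (_∈?_; ∣p∣≤n; ⊆-antisym; p⊆q⇒∣p∣≤∣q∣; p⊂q⇒∣p∣<∣q∣; x∉p⇒x∈∁p; x∈∁p⇒x∉p;
         p⊆p∪q; x∈p∪q⁺; x∈p∪q⁻; x∈⁅x⁆; x∈⁅y⁆⇒x≡y)
open import Data.Vec using ([]; _∷_; lookup)
open import Data.Vec.Properties using ([]=⇒lookup; lookup⇒[]=)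
open import Data.Vec.Functional using () renaming (_∷_ to _∷ᶠ_)
open import Data.Bool using (Bool; true; false; if_then_else_; not; _∧_; _∨_; _xor_)
open import Data.Bool.Properties using (∨-zeroʳ; ∧-identityʳ; ∧-inverseˡ)
open import Data.Product using (Σ; _×_; _,_; proj₁; proj₂)
open import Data.Sum using (_⊎_; inj₁; inj₂)
open import Data.Empty using (⊥-elim)
open import Relation.Nullary using (Dec; yes; no; ¬?)
open import Relation.Nullary.Decidable using (⌊_⌋; _×-dec_; _⊎-dec_; isYes≗does; dec-true)
open import Relation.Binary.Definitions using (tri<; tri≈; tri>)
open import Relation.Binary.PropositionalEquality
  using (_≡_; refl; sym; trans; cong; cong₂; subst; module ≡-Reasoning)
open import Algebra.Properties.CommutativeMonoid.Sum +-0-commutativeMonoid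
  using (sum; sum-cong-≗; ∑-distrib-+; ∑-comm)

ind : Bool → ℕ
ind b = if b then 1 else 0

-- sumFin is the library's finite sum over the monoid (ℕ, +, 0),
-- so the library's summation lemmas apply to it.
sumFin≡sum : ∀ {k} (f : Fin k → ℕ) → sumFin f ≡ sum f
sumFin≡sum {zero}  f = refl
sumFin≡sum {suc k} f = cong (f zero +_) (sumFin≡sum (λ i → f (suc i)))

sumFin-cong : ∀ {k} {f g : Fin k → ℕ} → (∀ i → f i ≡ g i) → sumFin f ≡ sumFin g
sumFin-cong {f = f} {g} f≗g =
  trans (sumFin≡sum f) (trans (sum-cong-≗ f≗g) (sym (sumFin≡sum g)))

sumFin-+ : ∀ {k} (f g : Fin k → ℕ) → sumFin (λ i → f i + g i) ≡ sumFin f + sumFin g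
sumFin-+ f g = trans (sumFin≡sum (λ i → f i + g i))
  (trans (∑-distrib-+ f g) (sym (cong₂ _+_ (sumFin≡sum f) (sumFin≡sum g))))

sumFin-swap : ∀ {k l} (F : Fin k → Fin l → ℕ) →
  sumFin (λ i → sumFin (λ j → F i j)) ≡ sumFin (λ j → sumFin (λ i → F i j))
sumFin-swap F = trans (double F) (trans (∑-comm F) (sym (double (λ j i → F i j))))
  where
  double : ∀ {k l} (H : Fin k → Fin l → ℕ) →
    sumFin (λ i → sumFin (H i)) ≡ sum (λ i → sum (H i))
  double H = trans (sumFin-cong (λ i → sumFin≡sum (H i))) (sumFin≡sum (λ i → sum (H i)))

sumFin-mono : ∀ {k} {f g : Fin k → ℕ} → (∀ i → f i ≤ g i) → sumFin f ≤ sumFin g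
sumFin-mono {zero}  f≤g = z≤n
sumFin-mono {suc k} f≤g = +-mono-≤ (f≤g zero) (sumFin-mono (λ i → f≤g (suc i)))

sumFin-const : ∀ k c → sumFin {k} (λ _ → c) ≡ k * c
sumFin-const zero    c = refl
sumFin-const (suc k) c = cong (c +_) (sumFin-const k c)

sumFin-zero : ∀ {k} {f : Fin k → ℕ} → (∀ i → f i ≡ 0) → sumFin f ≡ 0
sumFin-zero {k} f≡0 = trans (sumFin-cong f≡0) (trans (sumFin-const k 0) (*-zeroʳ k))

term≤sumFin : ∀ {k} (f : Fin k → ℕ) (i : Fin k) → f i ≤ sumFin f
term≤sumFin f zero    = m≤m+n _ _
term≤sumFin f (suc i) = ≤-trans (term≤sumFin (λ j → f (suc j)) i) (m≤n+m _ _)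

sumFin≤* : ∀ {k} (f : Fin k → ℕ) c → (∀ i → f i ≤ c) → sumFin f ≤ k * c
sumFin≤* {k} f c f≤c = ≤-trans (sumFin-mono f≤c) (≤-reflexive (sumFin-const k c))

sumFin≤*-except : ∀ {k} (f : Fin (suc k) → ℕ) c (i₀ : Fin (suc k)) → f i₀ ≡ 0 →
  (∀ i → f i ≤ c) → sumFin f ≤ k * c
sumFin≤*-except f c zero fi₀≡0 f≤c rewrite fi₀≡0 =
  sumFin≤* (λ i → f (suc i)) c (λ i → f≤c (suc i))
sumFin≤*-except {suc k} f c (suc i₀) fi₀≡0 f≤c =
  +-mono-≤ (f≤c zero) (sumFin≤*-except (λ i → f (suc i)) c i₀ fi₀≡0 (λ i → f≤c (suc i)))

pigeonhole : ∀ {k} (f : Fin k → ℕ) c → k * c < sumFin f → Σ (Fin k) λ i → c < f i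
pigeonhole {k} f c k*c<Σf with all? (λ i → f i ≤? c)
... | yes f≤c = ⊥-elim (<⇒≱ k*c<Σf (sumFin≤* f c f≤c))
... | no ¬f≤c with ¬∀⟶∃¬ k (λ i → f i ≤ c) (λ i → f i ≤? c) ¬f≤c
...   | i , fi≰c = i , ≰⇒> fi≰c

count-mono : ∀ {k} {p q : Fin k → Bool} → (∀ i → p i ≡ true → q i ≡ true) →
  count p ≤ count q
count-mono {p = p} {q} p⇒q = sumFin-mono (λ i → ind-mono (p i) (q i) (p⇒q i))
  where
  ind-mono : ∀ a b → (a ≡ true → b ≡ true) → ind a ≤ ind b
  ind-mono true  b a⇒b rewrite a⇒b refl = ≤-refl
  ind-mono false b a⇒b = z≤n

count-∨ : ∀ {k} (p q : Fin k → Bool) → count (λ i → p i ∨ q i) ≤ count p + count q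
count-∨ p q = ≤-trans (sumFin-mono (λ i → ind-∨ (p i) (q i)))
                      (≤-reflexive (sumFin-+ (λ i → ind (p i)) (λ i → ind (q i))))
  where
  ind-∨ : ∀ a b → ind (a ∨ b) ≤ ind a + ind b
  ind-∨ true  b = s≤s z≤n
  ind-∨ false b = ≤-refl

count-true : ∀ k → count {k} (λ _ → true) ≡ k
count-true k = trans (sumFin-const k 1) (*-identityʳ k)

count-false : ∀ {k} (p : Fin k → Bool) → (∀ i → p i ≡ false) → count p ≡ 0
count-false p p≡false = sumFin-zero (λ i → cong ind (p≡false i))

⌊⌋-true : ∀ {A : Set} (A? : Dec A) → A → ⌊ A? ⌋ ≡ true
⌊⌋-true A? a = trans (isYes≗does A?) (dec-true A? a)

not-mono : ∀ {a b} → (b ≡ true → a ≡ true) → not a ≡ true → not b ≡ true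
not-mono {b = false} _   _          = refl
not-mono {b = true}  b⇒a not-a≡true rewrite b⇒a refl = not-a≡true

∣p∣≡count : ∀ {k} (p : Subset k) → ∣ p ∣ ≡ count (lookup p)
∣p∣≡count []          = refl
∣p∣≡count (true  ∷ p) = cong suc (∣p∣≡count p)
∣p∣≡count (false ∷ p) = ∣p∣≡count p

module _ {G : Graph} where

  mapWalk : ∀ {ok ok′ : Edge G → Set} → (∀ e → ok e → ok′ e) →
    ∀ {a b} → Walk G ok a b → Walk G ok′ a b
  mapWalk ok⇒ok′ here         = here
  mapWalk ok⇒ok′ (fwd e oke w) = fwd e (ok⇒ok′ e oke) (mapWalk ok⇒ok′ w)
  mapWalk ok⇒ok′ (bwd e oke w) = bwd e (ok⇒ok′ e oke) (mapWalk ok⇒ok′ w)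

  infixr 5 _++ʷ_
  _++ʷ_ : ∀ {ok a b c} → Walk G ok a b → Walk G ok b c → Walk G ok a c
  here        ++ʷ w′ = w′
  fwd e oke w ++ʷ w′ = fwd e oke (w ++ʷ w′)
  bwd e oke w ++ʷ w′ = bwd e oke (w ++ʷ w′)

  reverseWalk : ∀ {ok a b} → Walk G ok a b → Walk G ok b a
  reverseWalk here          = here
  reverseWalk (fwd e oke w) = reverseWalk w ++ʷ bwd e oke here
  reverseWalk (bwd e oke w) = reverseWalk w ++ʷ fwd e oke here

Closed : (G : Graph) → (Edge G → Set) → Subset (n G) → Set
Closed G ok S = ∀ e → ok e → (src G e ∈ S → tgt G e ∈ S) × (tgt G e ∈ S → src G e ∈ S)

Reachable : (G : Graph) → (Edge G → Set) → Vertex G → Subset (n G) → Set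
Reachable G ok b S = ∀ u → (u ∈ S → Walk G ok b u) × (Walk G ok b u → u ∈ S)

module _ {G : Graph} {ok : Edge G → Set} {S : Subset (n G)} (S-closed : Closed G ok S) where

  stays : ∀ {a b} → a ∈ S → Walk G ok a b → b ∈ S
  stays a∈S here          = a∈S
  stays a∈S (fwd e oke w) = stays (proj₁ (S-closed e oke) a∈S) w
  stays a∈S (bwd e oke w) = stays (proj₂ (S-closed e oke) a∈S) w

  restrict : ∀ {a b} → a ∈ S → Walk G ok a b → Walk G (InducedEdge G S) a b
  restrict a∈S here          = here
  restrict a∈S (fwd e oke w) =
    fwd e (a∈S , proj₁ (S-closed e oke) a∈S) (restrict (proj₁ (S-closed e oke) a∈S) w)
  restrict a∈S (bwd e oke w) =
    bwd e (proj₂ (S-closed e oke) a∈S , a∈S) (restrict (proj₂ (S-closed e oke) a∈S) w)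

reachable-closed : ∀ {G ok b S} → Reachable G ok b S → Closed G ok S
reachable-closed {G} {S = S} reach e oke =
    (λ s∈S → proj₂ (reach (tgt G e)) (proj₁ (reach (src G e)) s∈S ++ʷ fwd e oke here))
  , (λ t∈S → proj₂ (reach (src G e)) (proj₁ (reach (tgt G e)) t∈S ++ʷ bwd e oke here))

-- It is grown from {b}: while some ok-edge leaves the current set, its outer
-- endpoint is added; the set grows strictly, so after at most n steps it is
-- closed, and then it contains every vertex reachable from b.
module _ (G : Graph) (ok : Edge G → Set) (ok? : ∀ e → Dec (ok e)) (b : Vertex G) where

  private
    Sound : Subset (n G) → Set
    Sound S = ∀ u → u ∈ S → Walk G ok b u

    Leaving : Subset (n G) → Edge G → Set
    Leaving S e = ok e × ((src G e ∈ S × tgt G e ∉ S) ⊎ (tgt G e ∈ S × src G e ∉ S))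

    leaving? : ∀ S e → Dec (Leaving S e)
    leaving? S e = ok? e ×-dec (((src G e ∈? S) ×-dec ¬? (tgt G e ∈? S))
                         ⊎-dec ((tgt G e ∈? S) ×-dec ¬? (src G e ∈? S)))

    closed-or-new : ∀ S → Sound S → Closed G ok S ⊎ Σ (Vertex G) λ x → x ∉ S × Walk G ok b x
    closed-or-new S sound with any? (leaving? S)
    ... | yes (e , oke , inj₁ (s∈S , t∉S)) =
      inj₂ (tgt G e , t∉S , sound (src G e) s∈S ++ʷ fwd e oke here)
    ... | yes (e , oke , inj₂ (t∈S , s∉S)) =
      inj₂ (src G e , s∉S , sound (tgt G e) t∈S ++ʷ bwd e oke here)
    ... | no none = inj₁ λ e oke → forward e oke , backward e oke
      where
      forward : ∀ e → ok e → src G e ∈ S → tgt G e ∈ S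
      forward e oke s∈S with tgt G e ∈? S
      ... | yes t∈S = t∈S
      ... | no t∉S  = ⊥-elim (none (e , oke , inj₁ (s∈S , t∉S)))
      backward : ∀ e → ok e → tgt G e ∈ S → src G e ∈ S
      backward e oke t∈S with src G e ∈? S
      ... | yes s∈S = s∈S
      ... | no s∉S  = ⊥-elim (none (e , oke , inj₂ (t∈S , s∉S)))

    grow : ∀ fuel S → n G < ∣ S ∣ + fuel → b ∈ S → Sound S → Σ (Subset (n G)) (Reachable G ok b)
    grow zero S n<∣S∣ _ _ = ⊥-elim (<⇒≱ n<∣S∣ (≤-trans (≤-reflexive (+-identityʳ ∣ S ∣)) (∣p∣≤n S)))
    grow (suc fuel) S n<∣S∣+fuel b∈S sound with closed-or-new S sound
    ... | inj₁ closed = S , λ u → sound u , stays closed b∈S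
    ... | inj₂ (x , x∉S , b⇝x) =
      grow fuel (S ∪ ⁅ x ⁆) n<∣S′∣+fuel (p⊆p∪q ⁅ x ⁆ b∈S) sound′
      where
      S⊂S′ : S ⊂ S ∪ ⁅ x ⁆
      S⊂S′ = p⊆p∪q ⁅ x ⁆ , x , x∈p∪q⁺ (inj₂ (x∈⁅x⁆ x)) , x∉S
      n<∣S′∣+fuel : n G < ∣ S ∪ ⁅ x ⁆ ∣ + fuel
      n<∣S′∣+fuel = ≤-trans n<∣S∣+fuel
        (≤-trans (≤-reflexive (+-suc ∣ S ∣ fuel)) (+-monoˡ-≤ fuel (p⊂q⇒∣p∣<∣q∣ S⊂S′)))
      sound′ : Sound (S ∪ ⁅ x ⁆)
      sound′ u u∈S′ with x∈p∪q⁻ S ⁅ x ⁆ u∈S′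
      ... | inj₁ u∈S  = sound u u∈S
      ... | inj₂ u∈x  rewrite x∈⁅y⁆⇒x≡y x u∈x = b⇝x

  reachable : Σ (Subset (n G)) (Reachable G ok b)
  reachable = grow (suc (n G)) ⁅ b ⁆ (m≤n+m (suc (n G)) ∣ ⁅ b ⁆ ∣) (x∈⁅x⁆ b)
    (λ u u∈b → subst (Walk G ok b) (sym (x∈⁅y⁆⇒x≡y b u∈b)) here)

-- K representatives such that every vertex is reachable from one of them
-- along ok-edges; i.e. the ok-edges leave at most K connected components.
Cover : (G : Graph) → (Edge G → Set) → ℕ → Set
Cover G ok K = Σ (Fin K → Vertex G) λ rep → ∀ u → Σ (Fin K) λ i → Walk G ok (rep i) u

cover-mono : ∀ {G ok ok′ K} → (∀ e → ok e → ok′ e) → Cover G ok K → Cover G ok′ K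
cover-mono ok⇒ok′ (rep , covers) =
  rep , λ u → proj₁ (covers u) , mapWalk ok⇒ok′ (proj₂ (covers u))

module _ {G : Graph} (ok : Edge G → Set) (x : Edge G) where

  Endpoint : Vertex G → Set
  Endpoint z = (z ≡ src G x) ⊎ (z ≡ tgt G x)

  split-at-edge : ∀ {a u} → Walk G (λ e → ok e ⊎ x ≡ e) a u →
    Walk G ok a u ⊎ ((Σ (Vertex G) λ z → Endpoint z × Walk G ok a z)
                   × (Σ (Vertex G) λ z → Endpoint z × Walk G ok z u))
  split-at-edge here = inj₁ here
  split-at-edge (fwd e (inj₁ oke) w) with split-at-edge w
  ... | inj₁ w′                       = inj₁ (fwd e oke w′)
  ... | inj₂ ((z , z-end , w₁) , rest) = inj₂ ((z , z-end , fwd e oke w₁) , rest)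
  split-at-edge (fwd e (inj₂ refl) w) with split-at-edge w
  ... | inj₁ w′       = inj₂ ((src G x , inj₁ refl , here) , (tgt G x , inj₂ refl , w′))
  ... | inj₂ (_ , rest) = inj₂ ((src G x , inj₁ refl , here) , rest)
  split-at-edge (bwd e (inj₁ oke) w) with split-at-edge w
  ... | inj₁ w′                       = inj₁ (bwd e oke w′)
  ... | inj₂ ((z , z-end , w₁) , rest) = inj₂ ((z , z-end , bwd e oke w₁) , rest)
  split-at-edge (bwd e (inj₂ refl) w) with split-at-edge w
  ... | inj₁ w′       = inj₂ ((tgt G x , inj₂ refl , here) , (src G x , inj₁ refl , w′))
  ... | inj₂ (_ , rest) = inj₂ ((tgt G x , inj₂ refl , here) , rest)

  -- Deleting one edge raises the number of components by at most one:
  -- if src x is reachable from an old representative, add tgt x, else add src x.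
  remove-edge : (∀ e → Dec (ok e)) → ∀ {K} →
    Cover G (λ e → ok e ⊎ x ≡ e) K → Cover G ok (suc K)
  remove-edge ok? {K} (rep , covers)
    with any? (λ i → src G x ∈? proj₁ (reachable G ok ok? (rep i)))
  ... | yes (i₀ , src∈) = (tgt G x ∷ᶠ rep) , covered
    where
    rep₀⇝src : Walk G ok (rep i₀) (src G x)
    rep₀⇝src = proj₁ (proj₂ (reachable G ok ok? (rep i₀)) (src G x)) src∈
    covered : ∀ u → Σ (Fin (suc K)) λ i → Walk G ok ((tgt G x ∷ᶠ rep) i) u
    covered u with split-at-edge (proj₂ (covers u))
    ... | inj₁ w                         = suc (proj₁ (covers u)) , w
    ... | inj₂ (_ , (_ , inj₁ refl , w)) = suc i₀ , rep₀⇝src ++ʷ w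
    ... | inj₂ (_ , (_ , inj₂ refl , w)) = zero , w
  ... | no src-unreached = (src G x ∷ᶠ rep) , covered
    where
    covered : ∀ u → Σ (Fin (suc K)) λ i → Walk G ok ((src G x ∷ᶠ rep) i) u
    covered u with split-at-edge (proj₂ (covers u))
    ... | inj₁ w                         = suc (proj₁ (covers u)) , w
    ... | inj₂ (_ , (_ , inj₁ refl , w)) = zero , w
    ... | inj₂ ((_ , inj₁ refl , w₁) , (_ , inj₂ refl , w)) =
      ⊥-elim (src-unreached (proj₁ (covers u) ,
        proj₂ (proj₂ (reachable G ok ok? (rep (proj₁ (covers u)))) (src G x)) w₁))
    ... | inj₂ ((_ , inj₂ refl , w₁) , (_ , inj₂ refl , w)) = suc (proj₁ (covers u)) , w₁ ++ʷ w

remove-edges : ∀ {G : Graph} (ok : Edge G → Set) (ok? : ∀ e → Dec (ok e)) →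
  ∀ {k} (extra : Fin k → Edge G) {K} →
  Cover G (λ e → ok e ⊎ Σ (Fin k) λ i → extra i ≡ e) K →
  Cover G ok (K + count (λ i → not ⌊ ok? (extra i) ⌋))
remove-edges {G} ok ok? {zero} extra {K} cov =
  subst (Cover G ok) (sym (+-identityʳ K)) (cover-mono (λ { e (inj₁ oke) → oke }) cov)
remove-edges {G} ok ok? {suc k} extra {K} cov with ok? (extra zero)
... | yes ok-x = remove-edges ok ok? (λ i → extra (suc i)) (cover-mono keep cov)
  where
  keep : ∀ e → (ok e ⊎ Σ (Fin (suc k)) λ i → extra i ≡ e) →
               ok e ⊎ Σ (Fin k) λ i → extra (suc i) ≡ e
  keep e (inj₁ oke)            = inj₁ oke
  keep e (inj₂ (zero  , refl)) = inj₁ ok-x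
  keep e (inj₂ (suc i , eq))   = inj₂ (i , eq)
... | no _ = subst (Cover G ok) (sym (+-suc K _))
  (remove-edges ok ok? (λ i → extra (suc i))
    (remove-edge ok′ (extra zero) ok′? (cover-mono split cov)))
  where
  ok′ : Edge G → Set
  ok′ e = ok e ⊎ Σ (Fin k) λ i → extra (suc i) ≡ e
  ok′? : ∀ e → Dec (ok′ e)
  ok′? e = ok? e ⊎-dec any? (λ i → extra (suc i) ≟ e)
  split : ∀ e → (ok e ⊎ Σ (Fin (suc k)) λ i → extra i ≡ e) → ok′ e ⊎ extra zero ≡ e
  split e (inj₁ oke)            = inj₁ (inj₁ oke)
  split e (inj₂ (zero  , eq))   = inj₂ eq
  split e (inj₂ (suc i , eq))   = inj₁ (inj₂ (i , eq))

Cut : (G : Graph) {r : ℕ} → (Vertex G → Fin r) → Edge G → Bool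
Cut G part e = not ⌊ part (src G e) ≟ part (tgt G e) ⌋

cutSize : (G : Graph) {r : ℕ} → (Vertex G → Fin r) → ℕ
cutSize G part = count (Cut G part)

-- A connected graph minus the cut edges of an allocation has at most
-- 1 + cutSize components: start from one component and delete all edges.
component-cover : ∀ (G : Graph) {r} (part : Vertex G → Fin r) → Connected G → Vertex G →
  Cover G (NotCut G part) (1 + cutSize G part)
component-cover G part connected v₀ =
  remove-edges (NotCut G part) (λ e → part (src G e) ≟ part (tgt G e)) (λ e → e)
    ((λ _ → v₀) , λ u → zero , mapWalk (λ e _ → inj₂ (e , refl)) (connected v₀ u))

record Components (G : Graph) {r : ℕ} (part : Vertex G → Fin r) (K : ℕ) : Set where
  field
    component    : Fin K → Subset (n G)
    is-component : ∀ i → IsComponent G part (component i)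
    covers       : ∀ u → Σ (Fin K) λ i → u ∈ component i

components-of : ∀ {G : Graph} {r} {part : Vertex G → Fin r} {K} →
  Cover G (NotCut G part) K → Components G part K
components-of {G} {part = part} (rep , reaches) = record
  { component    = λ i → proj₁ (component-through (rep i))
  ; is-component = λ i → rep i , proj₂ (component-through (rep i))
  ; covers       = λ u → proj₁ (reaches u) ,
      proj₂ (proj₂ (component-through (rep (proj₁ (reaches u)))) u) (proj₂ (reaches u))
  }
  where
  component-through : ∀ v → Σ (Subset (n G)) (Reachable G (NotCut G part) v)
  component-through = reachable G (NotCut G part) (λ e → part (src G e) ≟ part (tgt G e))

uncut-walk-part : ∀ {G : Graph} {r} {part : Vertex G → Fin r} {a b} →
  Walk G (NotCut G part) a b → part a ≡ part b
uncut-walk-part here            = refl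
uncut-walk-part (fwd e uncut w) = trans uncut (uncut-walk-part w)
uncut-walk-part (bwd e uncut w) = trans (sym uncut) (uncut-walk-part w)

component-in-part : ∀ {G : Graph} {r} {part : Vertex G → Fin r} {v C} →
  Reachable G (NotCut G part) v C → SubgraphOfPart G part C (part v)
component-in-part {G} {part = part} {v} {C} reach =
  in-part , λ e _ s∈C t∈C → in-part (src G e) s∈C , in-part (tgt G e) t∈C
  where
  in-part : ∀ u → u ∈ C → part u ≡ part v
  in-part u u∈C = sym (uncut-walk-part (proj₁ (reach u) u∈C))

-- Every cut edge is counted by α at the pair of parts it joins (in increasing
-- order), so a solution has at most w = Σ α cut edges.
cutSize≤totalα : ∀ (G : Graph) {r} (α : Fin r → Fin r → ℕ) (part : Vertex G → Fin r) →
  (∀ i j → i <ᶠ j → edgesBetween G part i j ≡ α i j) → cutSize G part ≤ totalα α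
cutSize≤totalα G {r} α part solution =
  ≤-trans (sumFin-mono cut-counted) (≤-reflexive (sym totalα≡))
  where
  Joins : Edge G → Fin r → Fin r → Bool
  Joins e i j = (⌊ part (src G e) ≟ i ⌋ ∧ ⌊ part (tgt G e) ≟ j ⌋)
              ∨ (⌊ part (src G e) ≟ j ⌋ ∧ ⌊ part (tgt G e) ≟ i ⌋)

  -- the contribution of edge e to α i j
  H : Fin r → Fin r → Edge G → ℕ
  H i j e = if ⌊ i <ᶠ? j ⌋ then ind (Joins e i j) else 0

  Hsum : Edge G → ℕ
  Hsum e = sumFin (λ i → sumFin (λ j → H i j e))

  α-as-sum : ∀ i j → (if ⌊ i <ᶠ? j ⌋ then α i j else 0) ≡ sumFin (H i j)
  α-as-sum i j with i <ᶠ? j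
  ... | yes i<j = sym (solution i j i<j)
  ... | no _    = sym (sumFin-zero {m G} (λ _ → refl))

  totalα≡ : totalα α ≡ sumFin Hsum
  totalα≡ = begin
      totalα α
    ≡⟨ sumFin-cong (λ i → sumFin-cong (λ j → α-as-sum i j)) ⟩
      sumFin (λ i → sumFin (λ j → sumFin (H i j)))
    ≡⟨ sumFin-cong (λ i → sumFin-swap (H i)) ⟩
      sumFin (λ i → sumFin (λ e → sumFin (λ j → H i j e)))
    ≡⟨ sumFin-swap (λ i e → sumFin (λ j → H i j e)) ⟩
      sumFin Hsum
    ∎
    where open ≡-Reasoning

  counted : ∀ e i j → i <ᶠ j → Joins e i j ≡ true → 1 ≤ Hsum e
  counted e i j i<j joins = ≤-trans (≤-reflexive (sym H≡1))
    (≤-trans (term≤sumFin (λ j → H i j e) j) (term≤sumFin (λ i → sumFin (λ j → H i j e)) i))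
    where
    H≡1 : H i j e ≡ 1
    H≡1 rewrite ⌊⌋-true (i <ᶠ? j) i<j | joins = refl

  straight crossed : Edge G → Bool
  straight e = ⌊ part (src G e) ≟ part (src G e) ⌋ ∧ ⌊ part (tgt G e) ≟ part (tgt G e) ⌋
  crossed  e = ⌊ part (src G e) ≟ part (tgt G e) ⌋ ∧ ⌊ part (tgt G e) ≟ part (src G e) ⌋

  own-parts : ∀ e → straight e ≡ true
  own-parts e = cong₂ _∧_ (⌊⌋-true (part (src G e) ≟ _) refl) (⌊⌋-true (part (tgt G e) ≟ _) refl)

  cut-counted : ∀ e → ind (Cut G part e) ≤ Hsum e
  cut-counted e with part (src G e) ≟ part (tgt G e)
  ... | yes _ = z≤n
  ... | no a≢c with <-cmp (part (src G e)) (part (tgt G e))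
  ...   | tri≈ _ a≡c _ = ⊥-elim (a≢c a≡c)
  ...   | tri< a<c _ _ = counted e (part (src G e)) (part (tgt G e)) a<c
                           (cong (_∨ crossed e) (own-parts e))
  ...   | tri> _ _ c<a = counted e (part (tgt G e)) (part (src G e)) c<a
                           (trans (cong (crossed e ∨_) (own-parts e)) (∨-zeroʳ (crossed e)))

crossing≤cutSize : ∀ (G : Graph) {r} (part : Vertex G → Fin r) (S : Subset (n G)) →
  Closed G (NotCut G part) S → crossing G S ≤ cutSize G part
crossing≤cutSize G part S closed = count-mono crossing-is-cut
  where
  crossing-is-cut : ∀ e → (⌊ src G e ∈? S ⌋ xor ⌊ tgt G e ∈? S ⌋) ≡ true → Cut G part e ≡ true
  crossing-is-cut e crosses with part (src G e) ≟ part (tgt G e)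
  ... | no _ = refl
  ... | yes uncut with src G e ∈? S | tgt G e ∈? S
  ...   | yes s∈S | no t∉S = ⊥-elim (t∉S (proj₁ (closed e uncut) s∈S))
  ...   | no s∉S | yes t∈S = ⊥-elim (s∉S (proj₂ (closed e uncut) t∈S))
  crossing-is-cut e () | yes _ | yes _ | yes _
  crossing-is-cut e () | yes _ | no _  | no _

reachable-same : ∀ {G ok v₁ v₂ C₁ C₂} → Reachable G ok v₁ C₁ → Reachable G ok v₂ C₂ →
  v₂ ∈ C₁ → C₂ ≡ C₁
reachable-same {G} {ok} {v₁} {v₂} {C₁} {C₂} reach₁ reach₂ v₂∈C₁ = ⊆-antisym C₂⊆C₁ C₁⊆C₂
  where
  v₁⇝v₂ : Walk G ok v₁ v₂
  v₁⇝v₂ = proj₁ (reach₁ v₂) v₂∈C₁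
  C₂⊆C₁ : C₂ ⊆ C₁
  C₂⊆C₁ {u} u∈C₂ = proj₂ (reach₁ u) (v₁⇝v₂ ++ʷ proj₁ (reach₂ u) u∈C₂)
  C₁⊆C₂ : C₁ ⊆ C₂
  C₁⊆C₂ {u} u∈C₁ = proj₂ (reach₂ u) (reverseWalk v₁⇝v₂ ++ʷ proj₁ (reach₁ u) u∈C₁)

hub-connected : ∀ {G : Graph} {S : Subset (n G)} (h : Vertex G) →
  (∀ u → u ∈ S → Walk G (InducedEdge G S) u h) → InducedConnected G S
hub-connected h to-hub u v u∈S v∈S = to-hub u u∈S ++ʷ reverseWalk (to-hub v v∈S)

-- Given the component C₁ of v₁ and a vertex v₂ outside it, let D be the set
-- of vertices reachable from v₂ in G - C₁.  Then (D, V ∖ D) separates the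
-- component of v₂ from C₁, is crossed only by cut edges, and both sides
-- induce connected graphs (the far side via C₁, using that G is connected).
module Separation (G : Graph) {r : ℕ} (part : Vertex G → Fin r) (connected : Connected G)
  {v₁ : Vertex G} {C₁ : Subset (n G)} (reach₁ : Reachable G (NotCut G part) v₁ C₁)
  {v₂ : Vertex G} (v₂∉C₁ : v₂ ∉ C₁) where

  Avoiding : Edge G → Set
  Avoiding e = src G e ∉ C₁ × tgt G e ∉ C₁

  avoiding? : ∀ e → Dec (Avoiding e)
  avoiding? e = ¬? (src G e ∈? C₁) ×-dec ¬? (tgt G e ∈? C₁)

  D : Subset (n G)
  D = proj₁ (reachable G Avoiding avoiding? v₂)

  reach₂ : Reachable G Avoiding v₂ D
  reach₂ = proj₂ (reachable G Avoiding avoiding? v₂)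

  C₁-closed : Closed G (NotCut G part) C₁
  C₁-closed = reachable-closed reach₁

  D-closed : Closed G Avoiding D
  D-closed = reachable-closed reach₂

  uncut-from-src : ∀ e → NotCut G part e → src G e ∉ C₁ → tgt G e ∉ C₁
  uncut-from-src e uncut s∉C₁ t∈C₁ = s∉C₁ (proj₂ (C₁-closed e uncut) t∈C₁)

  uncut-from-tgt : ∀ e → NotCut G part e → tgt G e ∉ C₁ → src G e ∉ C₁
  uncut-from-tgt e uncut t∉C₁ s∈C₁ = t∉C₁ (proj₁ (C₁-closed e uncut) s∈C₁)

  avoid : ∀ {a b} → a ∉ C₁ → Walk G (NotCut G part) a b → Walk G Avoiding a b
  avoid a∉C₁ here = here
  avoid a∉C₁ (fwd e uncut w) =
    fwd e (a∉C₁ , uncut-from-src e uncut a∉C₁) (avoid (uncut-from-src e uncut a∉C₁) w)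
  avoid a∉C₁ (bwd e uncut w) =
    bwd e (uncut-from-tgt e uncut a∉C₁ , a∉C₁) (avoid (uncut-from-tgt e uncut a∉C₁) w)

  outside-C₁-closed : Closed G Avoiding (∁ C₁)
  outside-C₁-closed e (s∉C₁ , t∉C₁) = (λ _ → x∉p⇒x∈∁p t∉C₁) , (λ _ → x∉p⇒x∈∁p s∉C₁)

  D∩C₁≡∅ : ∀ {u} → u ∈ D → u ∉ C₁
  D∩C₁≡∅ {u} u∈D =
    x∈∁p⇒x∉p (stays outside-C₁-closed (x∉p⇒x∈∁p v₂∉C₁) (proj₁ (reach₂ u) u∈D))

  C₁⊆∁D : C₁ ⊆ ∁ D
  C₁⊆∁D u∈C₁ = x∉p⇒x∈∁p (λ u∈D → D∩C₁≡∅ u∈D u∈C₁)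

  component⊆D : ∀ {C₂} → Reachable G (NotCut G part) v₂ C₂ → C₂ ⊆ D
  component⊆D reach {u} u∈C₂ = proj₂ (reach₂ u) (avoid v₂∉C₁ (proj₁ (reach u) u∈C₂))

  -- an uncut edge with one end in D lies in G - C₁, so it cannot leave D
  D-uncut-closed : Closed G (NotCut G part) D
  D-uncut-closed e uncut =
      (λ s∈D → proj₁ (D-closed e (D∩C₁≡∅ s∈D , uncut-from-src e uncut (D∩C₁≡∅ s∈D))) s∈D)
    , (λ t∈D → proj₂ (D-closed e (uncut-from-tgt e uncut (D∩C₁≡∅ t∈D) , D∩C₁≡∅ t∈D)) t∈D)

  D-connected : InducedConnected G D
  D-connected = hub-connected v₂ λ u u∈D →
    reverseWalk (restrict D-closed (proj₂ (reach₂ v₂) here) (proj₁ (reach₂ u) u∈D))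

  -- An edge from a vertex outside both C₁ and D cannot enter D,
  -- since an edge into D from outside C₁ lies in G - C₁.
  exit-src : ∀ e → src G e ∉ C₁ → src G e ∉ D → tgt G e ∉ D
  exit-src e s∉C₁ s∉D t∈D = s∉D (proj₂ (D-closed e (s∉C₁ , D∩C₁≡∅ t∈D)) t∈D)

  exit-tgt : ∀ e → tgt G e ∉ C₁ → tgt G e ∉ D → src G e ∉ D
  exit-tgt e t∉C₁ t∉D s∈D = t∉D (proj₁ (D-closed e (D∩C₁≡∅ s∈D , t∉C₁)) s∈D)

  -- A walk from outside D into C₁, cut at its first vertex in C₁, runs in G[V ∖ D].
  escape : ∀ {a b} → Walk G (AllEdges G) a b → b ∈ C₁ → a ∉ D →
    Σ (Vertex G) λ c → c ∈ C₁ × Walk G (InducedEdge G (∁ D)) a c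
  escape here b∈C₁ _ = _ , b∈C₁ , here
  escape (fwd e _ w) b∈C₁ s∉D with src G e ∈? C₁
  ... | yes s∈C₁ = src G e , s∈C₁ , here
  ... | no s∉C₁ with escape w b∈C₁ (exit-src e s∉C₁ s∉D)
  ...   | c , c∈C₁ , w′ =
    c , c∈C₁ , fwd e (x∉p⇒x∈∁p s∉D , x∉p⇒x∈∁p (exit-src e s∉C₁ s∉D)) w′
  escape (bwd e _ w) b∈C₁ t∉D with tgt G e ∈? C₁
  ... | yes t∈C₁ = tgt G e , t∈C₁ , here
  ... | no t∉C₁ with escape w b∈C₁ (exit-tgt e t∉C₁ t∉D)
  ...   | c , c∈C₁ , w′ =
    c , c∈C₁ , bwd e (x∉p⇒x∈∁p (exit-tgt e t∉C₁ t∉D) , x∉p⇒x∈∁p t∉D) w′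

  ∁D-connected : InducedConnected G (∁ D)
  ∁D-connected = hub-connected v₁ λ u u∈∁D →
    let c , c∈C₁ , u⇝c = escape (connected u v₁) v₁∈C₁ (x∈∁p⇒x∉p u∈∁D)
    in u⇝c ++ʷ reverseWalk (mapWalk into-∁D (restrict C₁-closed v₁∈C₁ (proj₁ (reach₁ c) c∈C₁)))
    where
    v₁∈C₁ : v₁ ∈ C₁
    v₁∈C₁ = proj₂ (reach₁ v₁) here
    into-∁D : ∀ e → InducedEdge G C₁ e → InducedEdge G (∁ D) e
    into-∁D e (s∈C₁ , t∈C₁) = C₁⊆∁D s∈C₁ , C₁⊆∁D t∈C₁

large-component-unique : ∀ (G : Graph) {r} (part : Vertex G → Fin r) {q y} →
  Connected G → NoGoodSeparation G q y → cutSize G part ≤ y →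
  ∀ {C₁ C₂} → IsComponent G part C₁ → IsComponent G part C₂ →
  q < ∣ C₁ ∣ → q < ∣ C₂ ∣ → C₂ ≡ C₁
large-component-unique G part connected no-separation cut≤y
  {C₁} (v₁ , reach₁) (v₂ , component₂) q<∣C₁∣ q<∣C₂∣ with v₂ ∈? C₁
... | yes v₂∈C₁ = reachable-same reach₁ component₂ v₂∈C₁
... | no v₂∉C₁ = ⊥-elim (no-separation D
      ( ≤-trans q<∣C₂∣ (p⊆q⇒∣p∣≤∣q∣ (component⊆D component₂))
      , ≤-trans q<∣C₁∣ (p⊆q⇒∣p∣≤∣q∣ C₁⊆∁D)
      , ≤-trans (crossing≤cutSize G part D D-uncut-closed) cut≤y
      , D-connected , ∁D-connected))
  where open Separation G part connected reach₁ v₂∉C₁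

one-hot : ∀ {k} (x : Fin k) → count (λ i → ⌊ x ≟ i ⌋) ≡ 1
one-hot {suc k} zero = cong suc (count-false {k} (λ i → ⌊ zero ≟ suc i ⌋) (λ i → refl))
one-hot (suc x)      = trans (sumFin-cong (λ i → cong ind (suc≟suc i))) (one-hot x)
  where
  suc≟suc : ∀ i → ⌊ suc x ≟ suc i ⌋ ≡ ⌊ x ≟ i ⌋
  suc≟suc i with x ≟ i
  ... | yes _ = refl
  ... | no _  = refl

one-hot-except : ∀ {k} (x j : Fin k) →
  sumFin (λ i → if ⌊ i ≟ j ⌋ then 0 else ind ⌊ x ≟ i ⌋) ≡ ind (not ⌊ x ≟ j ⌋)
one-hot-except x j with x ≟ j
... | yes refl = sumFin-zero vanishes
  where
  vanishes : ∀ i → (if ⌊ i ≟ x ⌋ then 0 else ind ⌊ x ≟ i ⌋) ≡ 0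
  vanishes i with i ≟ x
  ... | yes _ = refl
  ... | no i≢x with x ≟ i
  ...   | yes x≡i = ⊥-elim (i≢x (sym x≡i))
  ...   | no _    = refl
... | no x≢j = trans (sumFin-cong unchanged) (one-hot x)
  where
  unchanged : ∀ i → (if ⌊ i ≟ j ⌋ then 0 else ind ⌊ x ≟ i ⌋) ≡ ind ⌊ x ≟ i ⌋
  unchanged i with i ≟ j
  ... | no _ = refl
  ... | yes refl with x ≟ i
  ...   | yes x≡j = ⊥-elim (x≢j x≡j)
  ...   | no _    = refl

out-of-part : ∀ (G : Graph) {r} (part : Vertex G → Fin r) (j : Fin r) →
  sumFin (λ i → if ⌊ i ≟ j ⌋ then 0 else partSize G part i) ≡ count (λ v → not ⌊ part v ≟ j ⌋)
out-of-part G part j = begin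
    sumFin (λ i → if ⌊ i ≟ j ⌋ then 0 else partSize G part i)
  ≡⟨ sumFin-cong (λ i → if-sum ⌊ i ≟ j ⌋ (λ v → ind ⌊ part v ≟ i ⌋)) ⟩
    sumFin (λ i → sumFin (λ v → if ⌊ i ≟ j ⌋ then 0 else ind ⌊ part v ≟ i ⌋))
  ≡⟨ sumFin-swap (λ i v → if ⌊ i ≟ j ⌋ then 0 else ind ⌊ part v ≟ i ⌋) ⟩
    sumFin (λ v → sumFin (λ i → if ⌊ i ≟ j ⌋ then 0 else ind ⌊ part v ≟ i ⌋))
  ≡⟨ sumFin-cong (λ v → one-hot-except (part v) j) ⟩
    count (λ v → not ⌊ part v ≟ j ⌋)
  ∎
  where
  open ≡-Reasoning
  if-sum : ∀ {k} b (f : Fin k → ℕ) →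
    (if b then 0 else sumFin f) ≡ sumFin (λ v → if b then 0 else f v)
  if-sum {k} true f = sym (sumFin-zero {k} (λ _ → refl))
  if-sum false f    = refl

bounded-out-of : ∀ (G : Graph) {r} (part : Vertex G → Fin r) {x j} (C : Subset (n G)) →
  (∀ v → v ∈ C → part v ≡ j) → count (λ v → not (lookup C v)) ≤ x → BoundedOutOf G part x j
bounded-out-of G part {x} {j} C C⊆part outside≤x =
  ≤-trans (≤-reflexive (out-of-part G part j))
          (≤-trans (count-mono outside-part⇒outside-C) outside≤x)
  where
  outside-part⇒outside-C : ∀ v → not ⌊ part v ≟ j ⌋ ≡ true → not (lookup C v) ≡ true
  outside-part⇒outside-C v =
    not-mono (λ v∈C → ⌊⌋-true (part v ≟ j) (C⊆part v (lookup⇒[]= v C v∈C)))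

-- An allocation of more than 2x vertices is x-bounded out of at most one part:
-- every vertex lies outside j or outside j′.
bounded-unique : ∀ (G : Graph) {r} (part : Vertex G → Fin r) {x} (j j′ : Fin r) →
  2 * x < n G → BoundedOutOf G part x j → BoundedOutOf G part x j′ → j′ ≡ j
bounded-unique G part {x} j j′ n>2x bounded bounded′ with j′ ≟ j
... | yes j′≡j = j′≡j
... | no j′≢j = ⊥-elim (<⇒≱ n>2x (begin
    n G
  ≡⟨ sym (count-true (n G)) ⟩
    count {n G} (λ _ → true)
  ≤⟨ count-mono (λ v _ → outside-one (part v)) ⟩
    count (λ v → not ⌊ part v ≟ j ⌋ ∨ not ⌊ part v ≟ j′ ⌋)
  ≤⟨ count-∨ (λ v → not ⌊ part v ≟ j ⌋) (λ v → not ⌊ part v ≟ j′ ⌋) ⟩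
    count (λ v → not ⌊ part v ≟ j ⌋) + count (λ v → not ⌊ part v ≟ j′ ⌋)
  ≤⟨ +-mono-≤ (outside j bounded) (outside j′ bounded′) ⟩
    x + x
  ≡⟨ cong (x +_) (sym (+-identityʳ x)) ⟩
    2 * x
  ∎))
  where
  open ≤-Reasoning
  outside : ∀ i → BoundedOutOf G part x i → count (λ v → not ⌊ part v ≟ i ⌋) ≤ x
  outside i = ≤-trans (≤-reflexive (sym (out-of-part G part i)))
  outside-one : ∀ p → (not ⌊ p ≟ j ⌋ ∨ not ⌊ p ≟ j′ ⌋) ≡ true
  outside-one p with p ≟ j
  ... | no _ = refl
  ... | yes refl with p ≟ j′
  ...   | no _       = refl
  ...   | yes p≡j′ = ⊥-elim (j′≢j (sym p≡j′))

module _ {N K : ℕ} (S : Fin (suc K) → Subset N) (covers : ∀ u → Σ (Fin (suc K)) λ i → u ∈ S i) where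

  cover-count : (D : Fin N → Bool) →
    count D ≤ sumFin (λ i → count (λ u → D u ∧ lookup (S i) u))
  cover-count D = ≤-trans (sumFin-mono counted)
    (≤-reflexive (sumFin-swap (λ u i → ind (D u ∧ lookup (S i) u))))
    where
    counted : ∀ u → ind (D u) ≤ sumFin (λ i → ind (D u ∧ lookup (S i) u))
    counted u = ≤-trans (≤-reflexive (cong ind in-S))
      (term≤sumFin (λ i → ind (D u ∧ lookup (S i) u)) (proj₁ (covers u)))
      where
      in-S : D u ≡ (D u ∧ lookup (S (proj₁ (covers u))) u)
      in-S = sym (trans (cong (D u ∧_) ([]=⇒lookup (proj₂ (covers u)))) (∧-identityʳ (D u)))

  some-large : ∀ {q} → suc K * q < N → Σ (Fin (suc K)) λ i → q < ∣ S i ∣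
  some-large {q} N-large = pigeonhole (λ i → ∣ S i ∣) q (≤-trans N-large N≤Σ∣S∣)
    where
    open ≤-Reasoning
    N≤Σ∣S∣ : N ≤ sumFin (λ i → ∣ S i ∣)
    N≤Σ∣S∣ = begin
        N
      ≡⟨ sym (count-true N) ⟩
        count {N} (λ _ → true)
      ≤⟨ cover-count (λ _ → true) ⟩
        sumFin (λ i → count (lookup (S i)))
      ≡⟨ sumFin-cong (λ i → sym (∣p∣≡count (S i))) ⟩
        sumFin (λ i → ∣ S i ∣)
      ∎

  -- If every set with more than q points is S i₀, at most K q points lie outside S i₀:
  -- each of the other K sets contributes at most q of them.
  few-outside : ∀ {q} (i₀ : Fin (suc K)) → (∀ i → q < ∣ S i ∣ → S i ≡ S i₀) →
    count (λ u → not (lookup (S i₀) u)) ≤ K * q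
  few-outside {q} i₀ only-large =
    ≤-trans (cover-count outside) (sumFin≤*-except outside-in q i₀ none-in-S₀ at-most-q)
    where
    outside : Fin N → Bool
    outside u = not (lookup (S i₀) u)
    outside-in : Fin (suc K) → ℕ
    outside-in i = count (λ u → outside u ∧ lookup (S i) u)
    none-in-S₀ : outside-in i₀ ≡ 0
    none-in-S₀ =
      count-false (λ u → outside u ∧ lookup (S i₀) u) (λ u → ∧-inverseˡ (lookup (S i₀) u))
    ∧-true-right : ∀ a {b} → (a ∧ b) ≡ true → b ≡ true
    ∧-true-right true  b≡true = b≡true
    ∧-true-right false ()
    at-most-q : ∀ i → outside-in i ≤ q
    at-most-q i with q <? ∣ S i ∣
    ... | yes large rewrite only-large i large = ≤-trans (≤-reflexive none-in-S₀) z≤n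
    ... | no ¬large = ≤-trans (count-mono (λ u → ∧-true-right (outside u)))
        (≤-trans (≤-reflexive (sym (∣p∣≡count (S i)))) (≮⇒≥ ¬large))

-- 1 + c ≤ 2w for c ≤ w and w ≥ 1: with at most w cut edges, the at most
-- 1 + w components number at most 2w.
suc≤double : ∀ {c w} → 0 < w → c ≤ w → suc c ≤ 2 * w
suc≤double {w = w} 0<w c≤w =
  ≤-trans (+-mono-≤ 0<w c≤w) (≤-reflexive (cong (w +_) (sym (+-identityʳ w))))

lemma9 : (G : Graph) (r : ℕ) → 1 ≤ r → (lam : Vertex G → Subset r)
         (α : Fin r → Fin r → ℕ) (part : Vertex G → Fin r) →
         HighlyConnected G r α →
         IsSolution G r lam α part →
         2 * totalα α * f₂ (totalα α) < n G →
         Σ (Fin r) λ j → Σ (Subset (n G)) λ C →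
           (BoundedOutOf G part (totalα α * f₂ (totalα α)) j
             × (∀ j′ → BoundedOutOf G part (totalα α * f₂ (totalα α)) j′ → j′ ≡ j))
           × (IsComponent G part C × f₂ (totalα α) < ∣ C ∣
             × (∀ C′ → IsComponent G part C′ → f₂ (totalα α) < ∣ C′ ∣ → C′ ≡ C))
           × SubgraphOfPart G part C j
lemma9 G r 1≤r _ α part (connected , r≤2w , no-separation) (solution , _) n-large =
  j , C , (j-bounded , λ j′ → bounded-unique G part j j′ n>2WF j-bounded) ,
  (C-component , C-large , λ C′ C′-component → unique C-component C′-component C-large) ,
  C-in-part
  where
  W F : ℕ
  W = totalα α
  F = f₂ W
  cut≤W : cutSize G part ≤ W
  cut≤W = cutSize≤totalα G α part solution
  unique : ∀ {C₁ C₂} → IsComponent G part C₁ → IsComponent G part C₂ →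
           F < ∣ C₁ ∣ → F < ∣ C₂ ∣ → C₂ ≡ C₁
  unique = large-component-unique G part connected no-separation cut≤W
  v₀ : Vertex G
  v₀ = fromℕ< (≤-<-trans z≤n n-large)
  -- at most 1 + W components cover G, and 2 W F < n, so one of them is large
  open Components (components-of {part = part} (component-cover G part connected v₀))
  large : Σ (Fin (suc (cutSize G part))) λ i₀ → F < ∣ component i₀ ∣
  large = some-large component covers
    (≤-<-trans (*-monoˡ-≤ F (suc≤double (*-cancelˡ-< 2 0 W (≤-trans 1≤r r≤2w)) cut≤W)) n-large)
  C : Subset (n G)
  C = component (proj₁ large)
  C-component : IsComponent G part C
  C-component = is-component (proj₁ large)
  C-large : F < ∣ C ∣
  C-large = proj₂ large
  j : Fin r
  j = part (proj₁ C-component)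
  C-in-part : SubgraphOfPart G part C j
  C-in-part = component-in-part (proj₂ C-component)
  -- every other component is small, so at most W F vertices lie outside C ⊆ 𝒱⁽ʲ⁾
  j-bounded : BoundedOutOf G part (W * F) j
  j-bounded = bounded-out-of G part C (proj₁ C-in-part)
    (≤-trans (few-outside component covers (proj₁ large)
               (λ i → unique C-component (is-component i) C-large))
             (*-monoˡ-≤ F cut≤W))
  n>2WF : 2 * (W * F) < n G
  n>2WF = subst (_< n G) (*-assoc 2 W F) n-large
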